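{- For every integer $m\ge 1$ there exists an $(m,2^m-1,1)$-domination mapping that is a bijection from $\{0,1\}^m$ onto $\mathcal{B}(2^m-1,1)$. Consequently $\nu(m,1)=2^m-1$ for all $m\ge 1$, and $\mu(n,1)=\lfloor\log_2(n+1)\rfloor$ for all $n\ge 1$.
   Context: For $y \in \{0,1\}^n$, $\mathrm{wt}(y)$ is the number of nonzero coordinates, and $\mathcal{B}(n,w)=\{y\in\{0,1\}^n : \mathrm{wt}(y)\le w\}$. A domination graph is a bipartite graph $G=([m]\cup[n],E)$ with left vertex set $[m]$ and right vertex set $[n]$ having no isolated right vertices. An injective map $\varphi:\{0,1\}^m\to\mathcal{B}(n,w)$ is $G$-dominating if for every $x\in\{0,1\}^m$ and every edge $(i,j)\in E$: $x_i=0$ implies that the $j$-th coordinate of $\varphi(x)$ is $0$. An $(m,n,w)$-domination mapping is an injective map $\{0,1\}^m\to\mathcal{B}(n,w)$ that is $G$-dominating for some domination graph $G=([m]\cup[n],E)$. $\nu(m,w)$ is the minimum $n$ such that an $(m,n,w)$-domination mapping exists, and $\mu(n,w)$ is the maximum $m$ such that an $(m,n,w)$-domination mapping exists. -}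

module Defs where

open import Data.Nat using (ℕ; zero; suc; _≤_)
open import Data.Bool using (Bool; true; false)
open import Data.Fin using (Fin)
open import Data.Vec using (Vec; []; _∷_; lookup)
open import Data.Product using (Σ; ∃; _×_)
open import Relation.Binary.PropositionalEquality using (_≡_)
open import Function.Definitions using (Injective)

-- Binary words of length n are vectors of booleans (true = 1, false = 0).

wt : ∀ {n} → Vec Bool n → ℕ
wt []           = zero
wt (true  ∷ ys) = suc (wt ys)
wt (false ∷ ys) = wt ys

InBall : ∀ {n} → ℕ → Vec Bool n → Set
InBall w y = wt y ≤ w

BipGraph : ℕ → ℕ → Set
BipGraph m n = Fin m → Fin n → Bool

IsDominationGraph : ∀ {m n} → BipGraph m n → Set
IsDominationGraph {m} {n} G = (j : Fin n) → ∃ λ (i : Fin m) → G i j ≡ true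

IsDominating : ∀ {m n} → BipGraph m n → (Vec Bool m → Vec Bool n) → Set
IsDominating {m} {n} G φ =
  (x : Vec Bool m) (i : Fin m) (j : Fin n) →
  G i j ≡ true → lookup x i ≡ false → lookup (φ x) j ≡ false

IsDominationMapping : (m n w : ℕ) → (Vec Bool m → Vec Bool n) → Set
IsDominationMapping m n w φ =
  ((x : Vec Bool m) → InBall w (φ x)) ×
  Injective _≡_ _≡_ φ ×
  (∃ λ (G : BipGraph m n) → IsDominationGraph G × IsDominating G φ)

HasDominationMapping : (m n w : ℕ) → Set
HasDominationMapping m n w = ∃ λ φ → IsDominationMapping m n w φ

IsNu : (m w k : ℕ) → Set
IsNu m w k = HasDominationMapping m k w × ((n : ℕ) → HasDominationMapping m n w → k ≤ n)

IsMu : (n w k : ℕ) → Set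
IsMu n w k = HasDominationMapping k n w × ((m : ℕ) → HasDominationMapping m n w → m ≤ k)

module Submission where

-- Index the coordinates of {0,1}^(2^m - 1) by the nonempty
-- subsets S ⊆ [m] and send x to the unit vector at the coordinate supp(x)
-- (and 0 to 0).  This map φ is a bijection {0,1}^m → B(2^m - 1, 1), and it is
-- dominating for the graph joining i to S iff i ∈ S: if x_i = 0, the only
-- coordinate where φ(x) may be 1 is supp(x), which does not contain i.
-- In Agda the subsets are listed recursively: for m + 1 letters, first the
-- 2^m - 1 nonempty subsets S of the last m letters, then {0}, then {0} ∪ S.
--
-- Minimality is counting: a word of weight ≤ 1 is determined by the position
-- of its 1, so B(n,1) injects into Fin (n + 1), and an injective map
-- {0,1}^m → B(n,1) forces 2^m ≤ n + 1.  This gives ν(m,1) = 2^m - 1, and for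
-- μ(n,1) it gives the upper bound; the lower bound pads the mapping for
-- k = ⌊log₂(n+1)⌋ with zero coordinates, using 2^⌊log₂ n⌋ ≤ n.

open import Defs
open import Data.Nat using (ℕ; zero; suc; _+_; _∸_; _^_; _≤_; _<_; z≤n; s≤s; ⌊_/2⌋; ⌈_/2⌉; _≡ᵇ_)
open import Data.Nat.Properties
open import Data.Nat.Induction using (<-rec)
open import Data.Nat.Logarithm using (⌊log₂_⌋; ⌊log₂⌋-mono-≤; ⌊log₂[2^n]⌋≡n; ⌊log₂⌊n/2⌋⌋≡⌊log₂n⌋∸1)
open import Data.Bool using (Bool; true; false; if_then_else_)
open import Data.Vec using (Vec; []; _∷_; _++_; replicate; lookup; tabulate; splitAt)
open import Data.Vec.Properties using (++-injectiveˡ; ++-injectiveʳ; ∷-injectiveˡ; ∷-injectiveʳ; lookup-splitAt; lookup-replicate; lookup∘tabulate)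
open import Data.Fin as Fin using (Fin; fromℕ; inject₁; finToFun; funToFin; combine)
open import Data.Fin.Properties using (inject₁-injective; fromℕ≢inject₁; injective⇒≤; funToFin-finToFin; 2↔Bool)
open import Data.Sum using (_⊎_; inj₁; inj₂)
open import Data.Product using (Σ; ∃; _×_; _,_)
open import Data.Empty using (⊥-elim)
open import Relation.Nullary using (¬_)
open import Function using (_∘_; Inverse)
open import Function.Definitions using (Injective)
open import Function.Bundles using (Injection)
open import Function.Properties.Inverse using (↔⇒↣)
open import Relation.Binary.PropositionalEquality

zeros : ∀ k → Vec Bool k
zeros k = replicate k false

wt-zeros : ∀ k → wt (zeros k) ≡ 0
wt-zeros zero    = refl
wt-zeros (suc k) = wt-zeros k

wt≡0⇒zeros : ∀ {k} (v : Vec Bool k) → wt v ≡ 0 → v ≡ zeros k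
wt≡0⇒zeros []          _  = refl
wt≡0⇒zeros (false ∷ v) w0 = cong (false ∷_) (wt≡0⇒zeros v w0)

wt-++ : ∀ {a b} (xs : Vec Bool a) (ys : Vec Bool b) → wt (xs ++ ys) ≡ wt xs + wt ys
wt-++ []           ys = refl
wt-++ (true  ∷ xs) ys = cong suc (wt-++ xs ys)
wt-++ (false ∷ xs) ys = wt-++ xs ys

wt≤1-++ : ∀ {a b} (xs : Vec Bool a) (ys : Vec Bool b) → wt (xs ++ ys) ≤ 1 →
          (wt xs ≤ 1 × ys ≡ zeros b) ⊎ (xs ≡ zeros a × wt ys ≡ 1)
wt≤1-++ xs ys ball rewrite wt-++ xs ys with wt ys in wys
... | zero        = inj₁ (subst (_≤ 1) (+-identityʳ (wt xs)) ball , wt≡0⇒zeros ys wys)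
... | suc zero    = inj₂ (wt≡0⇒zeros xs (n≤0⇒n≡0 (+-cancelʳ-≤ 1 (wt xs) 0 ball)) , refl)
... | suc (suc k) = ⊥-elim (2+k≰1 (m+n≤o⇒n≤o (wt xs) ball))
  where
  2+k≰1 : ¬ (2 + k ≤ 1)
  2+k≰1 (s≤s ())

zeros-++ : ∀ a b → zeros a ++ zeros b ≡ zeros (a + b)
zeros-++ zero    b = refl
zeros-++ (suc a) b = cong (false ∷_) (zeros-++ a b)

wt-++-zeros : ∀ {a} (xs : Vec Bool a) d → wt (xs ++ zeros d) ≡ wt xs
wt-++-zeros xs d = trans (wt-++ xs (zeros d)) (trans (cong (wt xs +_) (wt-zeros d)) (+-identityʳ (wt xs)))

isZero : ∀ {m} → Vec Bool m → Bool
isZero []          = true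
isZero (true  ∷ _) = false
isZero (false ∷ x) = isZero x

isZero-zeros : ∀ m → isZero (zeros m) ≡ true
isZero-zeros zero    = refl
isZero-zeros (suc m) = isZero-zeros m

-- N m is the number of nonempty subsets of [m], listed as described above.
N : ℕ → ℕ
N zero    = zero
N (suc m) = N m + suc (N m)

N+1≡2^m : ∀ m → N m + 1 ≡ 2 ^ m
N+1≡2^m zero    = refl
N+1≡2^m (suc m) = begin
  N m + suc (N m) + 1       ≡⟨ +-assoc (N m) (suc (N m)) 1 ⟩
  N m + (1 + (N m + 1))     ≡⟨ +-assoc (N m) 1 (N m + 1) ⟨
  (N m + 1) + (N m + 1)     ≡⟨ cong (λ t → t + t) (N+1≡2^m m) ⟩
  2 ^ m + 2 ^ m             ≡⟨ cong (2 ^ m +_) (+-identityʳ (2 ^ m)) ⟨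
  2 ^ m + (2 ^ m + 0)       ∎
  where open ≡-Reasoning

N≡2^m∸1 : ∀ m → N m ≡ 2 ^ m ∸ 1
N≡2^m∸1 m = trans (sym (m+n∸n≡m (N m) 1)) (cong (_∸ 1) (N+1≡2^m m))

-- φ x is the unit vector at the coordinate supp(x), or 0 if x = 0.  For
-- x = 0∷x' the support is a subset of the last m letters (first block); for
-- x = 1∷x' it is {0} (middle coordinate, when x' = 0) or {0} ∪ supp(x').
φ : ∀ m → Vec Bool m → Vec Bool (N m)
φ zero    []          = []
φ (suc m) (false ∷ x) = φ m x ++ (false ∷ zeros (N m))
φ (suc m) (true  ∷ x) = zeros (N m) ++ (isZero x ∷ φ m x)

wt-φ : ∀ m (x : Vec Bool m) → wt (φ m x) ≡ (if isZero x then 0 else 1)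
wt-φ zero    []          = refl
wt-φ (suc m) (false ∷ x) = trans (wt-++-zeros (φ m x) (suc (N m))) (wt-φ m x)
wt-φ (suc m) (true  ∷ x) rewrite wt-++ (zeros (N m)) (isZero x ∷ φ m x) | wt-zeros (N m)
  with isZero x | wt-φ m x
... | true  | w0 = cong suc w0
... | false | w1 = w1

isZero≡wt-φ≡0 : ∀ m (x : Vec Bool m) → isZero x ≡ (wt (φ m x) ≡ᵇ 0)
isZero≡wt-φ≡0 m x rewrite wt-φ m x with isZero x
... | true  = refl
... | false = refl

φ-ball : ∀ m (x : Vec Bool m) → InBall 1 (φ m x)
φ-ball m x rewrite wt-φ m x with isZero x
... | true  = z≤n
... | false = s≤s z≤n

φ-zeros : ∀ m → φ m (zeros m) ≡ zeros (N m)
φ-zeros zero    = refl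
φ-zeros (suc m) = trans (cong (_++ zeros (suc (N m))) (φ-zeros m)) (zeros-++ (N m) (suc (N m)))

φ≡zeros⇒isZero : ∀ m (y : Vec Bool m) → φ m y ≡ zeros (N m) → isZero y ≡ true
φ≡zeros⇒isZero m y φy≡0 =
  trans (isZero≡wt-φ≡0 m y) (cong (_≡ᵇ 0) (trans (cong wt φy≡0) (wt-zeros (N m))))

φ-injective : ∀ m → Injective _≡_ _≡_ (φ m)
φ-injective zero    {[]}        {[]}        _ = refl
φ-injective (suc m) {false ∷ x} {false ∷ y} e =
  cong (false ∷_) (φ-injective m (++-injectiveˡ (φ m x) (φ m y) e))
φ-injective (suc m) {true ∷ x}  {true ∷ y}  e =
  cong (true ∷_) (φ-injective m (∷-injectiveʳ (++-injectiveʳ (zeros (N m)) (zeros (N m)) e)))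
φ-injective (suc m) {false ∷ x} {true ∷ y}  e = ⊥-elim (first≢second e)
  where
  -- the second block of φ(1∷y) is isZero y ∷ φ y, which is never 0∷0.
  first≢second : ¬ (φ m x ++ (false ∷ zeros (N m)) ≡ zeros (N m) ++ (isZero y ∷ φ m y))
  first≢second e with ++-injectiveʳ (φ m x) (zeros (N m)) e
  ... | tails with () ← trans (∷-injectiveˡ tails) (φ≡zeros⇒isZero m y (sym (∷-injectiveʳ tails)))
φ-injective (suc m) {true ∷ x}  {false ∷ y} e = sym (φ-injective (suc m) (sym e))

φ-onto-ball : ∀ m (y : Vec Bool (N m)) → InBall 1 y → ∃ λ x → φ m x ≡ y
φ-onto-ball zero    []  _    = [] , refl
φ-onto-ball (suc m) y  ball with splitAt (N m) y
φ-onto-ball (suc m) .(ys ++ (b ∷ zs)) ball | ys , b ∷ zs , refl with wt≤1-++ ys (b ∷ zs) ball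
... | inj₁ (ys-ball , b∷zs≡0) =
  let (x , φx≡ys) = φ-onto-ball m ys ys-ball
  in  false ∷ x , cong₂ _++_ φx≡ys (sym b∷zs≡0)
φ-onto-ball (suc m) .(ys ++ (true ∷ zs)) ball | ys , true ∷ zs , refl | inj₂ (ys≡0 , wzs) =
  true ∷ zeros m ,
  cong₂ _++_ (sym ys≡0) (cong₂ _∷_ (isZero-zeros m) (trans (φ-zeros m) (sym (wt≡0⇒zeros zs (suc-injective wzs)))))
φ-onto-ball (suc m) .(ys ++ (false ∷ zs)) ball | ys , false ∷ zs , refl | inj₂ (ys≡0 , wzs) =
  let (x , φx≡zs) = φ-onto-ball m zs (≤-reflexive wzs)
      x≢0 : isZero x ≡ false
      x≢0 = trans (isZero≡wt-φ≡0 m x) (cong (_≡ᵇ 0) (trans (cong wt φx≡zs) wzs))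
  in  true ∷ x , cong₂ _++_ (sym ys≡0) (cong₂ _∷_ x≢0 φx≡zs)

-- The membership graph: letter i is joined to the coordinate of S iff i ∈ S.
-- For m + 1 letters, 'adjacentSuc' reads a coordinate as a position in the
-- first block (S), or in the second block (0 for {0}, suc k for {0} ∪ S_k).
mutual
  membership : ∀ m → BipGraph m (N m)
  membership zero    ()
  membership (suc m) i j = adjacentSuc m i (Fin.splitAt (N m) j)

  adjacentSuc : ∀ m → Fin (suc m) → Fin (N m) ⊎ Fin (suc (N m)) → Bool
  adjacentSuc m Fin.zero    (inj₁ _)             = false
  adjacentSuc m Fin.zero    (inj₂ _)             = true
  adjacentSuc m (Fin.suc i) (inj₁ k)             = membership m i k
  adjacentSuc m (Fin.suc i) (inj₂ Fin.zero)      = false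
  adjacentSuc m (Fin.suc i) (inj₂ (Fin.suc k))   = membership m i k

-- Every nonempty subset has an element.
membership-domination : ∀ m → IsDominationGraph (membership m)
membership-domination zero    ()
membership-domination (suc m) j with Fin.splitAt (N m) j
... | inj₁ k = let (i , i∈S) = membership-domination m k in Fin.suc i , i∈S
... | inj₂ k = Fin.zero , refl

φ-dominating : ∀ m → IsDominating (membership m) (φ m)
φ-dominating zero x i ()
φ-dominating (suc m) (false ∷ x) i j i∈S xi≡0
  rewrite lookup-splitAt (N m) (φ m x) (false ∷ zeros (N m)) j with Fin.splitAt (N m) j | i
... | inj₁ k          | Fin.suc i' = φ-dominating m x i' k i∈S xi≡0
... | inj₂ Fin.zero    | _         = refl
... | inj₂ (Fin.suc k) | _         = lookup-replicate k false
φ-dominating (suc m) (true ∷ x) i j i∈S xi≡0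
  rewrite lookup-splitAt (N m) (zeros (N m)) (isZero x ∷ φ m x) j with Fin.splitAt (N m) j | i
... | inj₁ k           | _          = lookup-replicate k false
... | inj₂ (Fin.suc k) | Fin.suc i' = φ-dominating m x i' k i∈S xi≡0

φ-domination-mapping : ∀ m → IsDominationMapping m (N m) 1 (φ m)
φ-domination-mapping m =
  φ-ball m , φ-injective m , membership m , membership-domination m , φ-dominating m

-- A word of weight ≤ 1 is coded by the position of its 1 (the code n stands
-- for the zero word); on B(n,1) this code is injective.
position : ∀ {n} → Vec Bool n → Fin (suc n)
position []           = Fin.zero
position (false ∷ ys) = inject₁ (position ys)
position (true  ∷ ys) = fromℕ _

position-injective : ∀ {n} (a b : Vec Bool n) → InBall 1 a → InBall 1 b →
                     position a ≡ position b → a ≡ b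
position-injective []          []          _        _        _ = refl
position-injective (false ∷ a) (false ∷ b) a-ball   b-ball   e =
  cong (false ∷_) (position-injective a b a-ball b-ball (inject₁-injective e))
position-injective (true ∷ a)  (true ∷ b)  (s≤s a0) (s≤s b0) _ =
  cong (true ∷_) (trans (wt≡0⇒zeros a (n≤0⇒n≡0 a0)) (sym (wt≡0⇒zeros b (n≤0⇒n≡0 b0))))
position-injective (false ∷ a) (true ∷ b)  _        _        e = ⊥-elim (fromℕ≢inject₁ (sym e))
position-injective (true ∷ a)  (false ∷ b) _        _        e = ⊥-elim (fromℕ≢inject₁ e)

bits : ∀ m → Fin (2 ^ m) → Vec Bool m
bits m k = tabulate (Inverse.to 2↔Bool ∘ finToFun k)

funToFin-cong : ∀ {m n} {f g : Fin m → Fin n} → (∀ i → f i ≡ g i) → funToFin f ≡ funToFin g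
funToFin-cong {zero}  _   = refl
funToFin-cong {suc m} f≗g = cong₂ combine (f≗g Fin.zero) (funToFin-cong (f≗g ∘ Fin.suc))

bits-injective : ∀ m → Injective _≡_ _≡_ (bits m)
bits-injective m {k} {l} e = begin
  k                         ≡⟨ funToFin-finToFin {m} {2} k ⟨
  funToFin (digits k)       ≡⟨ funToFin-cong same-digit ⟩
  funToFin (digits l)       ≡⟨ funToFin-finToFin {m} {2} l ⟩
  l                         ∎
  where
  open ≡-Reasoning
  toBool = Inverse.to 2↔Bool
  digits : Fin (2 ^ m) → Fin m → Fin 2
  digits = finToFun
  same-digit : ∀ i → digits k i ≡ digits l i
  same-digit i = Injection.injective (↔⇒↣ 2↔Bool) (begin
    toBool (finToFun k i)   ≡⟨ lookup∘tabulate (toBool ∘ finToFun k) i ⟨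
    lookup (bits m k) i     ≡⟨ cong (λ v → lookup v i) e ⟩
    lookup (bits m l) i     ≡⟨ lookup∘tabulate (toBool ∘ finToFun l) i ⟩
    toBool (finToFun l i)   ∎)

ball-counting : ∀ m n (ψ : Vec Bool m → Vec Bool n) → (∀ x → InBall 1 (ψ x)) →
                Injective _≡_ _≡_ ψ → 2 ^ m ≤ suc n
ball-counting m n ψ ball ψ-injective = injective⇒≤ {f = position ∘ ψ ∘ bits m} injective
  where
  injective : Injective _≡_ _≡_ (position ∘ ψ ∘ bits m)
  injective e = bits-injective m (ψ-injective (position-injective _ _ (ball _) (ball _) e))

mapping-counting : ∀ m n → HasDominationMapping m n 1 → 2 ^ m ≤ suc n
mapping-counting m n (ψ , ball , ψ-injective , _) = ball-counting m n ψ ball ψ-injective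

-- At least one letter
-- is needed so that the new right vertices are not isolated.
pad : ∀ {m k w} d → HasDominationMapping (suc m) k w → HasDominationMapping (suc m) (k + d) w
pad {m} {k} {w} d (ψ , ball , ψ-injective , G , G-domination , ψ-dominating) =
  padded , padded-ball , padded-injective , G' , G'-domination , padded-dominating
  where
  padded : Vec Bool (suc m) → Vec Bool (k + d)
  padded x = ψ x ++ zeros d

  padded-ball : ∀ x → InBall w (padded x)
  padded-ball x = subst (_≤ w) (sym (wt-++-zeros (ψ x) d)) (ball x)

  padded-injective : Injective _≡_ _≡_ padded
  padded-injective {x} {y} e = ψ-injective (++-injectiveˡ (ψ x) (ψ y) e)

  extend : Fin (suc m) → Fin k ⊎ Fin d → Bool
  extend i (inj₁ a) = G i a
  extend i (inj₂ _) = true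

  G' : BipGraph (suc m) (k + d)
  G' i j = extend i (Fin.splitAt k j)

  G'-domination : IsDominationGraph G'
  G'-domination j with Fin.splitAt k j
  ... | inj₁ a = G-domination a
  ... | inj₂ _ = Fin.zero , refl

  padded-dominating : IsDominating G' padded
  padded-dominating x i j edge xi≡0 rewrite lookup-splitAt k (ψ x) (zeros d) j with Fin.splitAt k j
  ... | inj₁ a = ψ-dominating x i a edge xi≡0
  ... | inj₂ a = lookup-replicate a false

1≤⌊log₂⌋ : ∀ {n} → 2 ≤ n → 1 ≤ ⌊log₂ n ⌋
1≤⌊log₂⌋ {n} 2≤n = subst (_≤ ⌊log₂ n ⌋) (⌊log₂[2^n]⌋≡n 1) (⌊log₂⌋-mono-≤ 2≤n)

-- 2^⌊log₂ n⌋ ≤ n, by strong induction via ⌊log₂ n⌋ = 1 + ⌊log₂ ⌊n/2⌋⌋ for n ≥ 2.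
2^⌊log₂n⌋≤n : ∀ n → 1 ≤ n → 2 ^ ⌊log₂ n ⌋ ≤ n
2^⌊log₂n⌋≤n = <-rec (λ n → 1 ≤ n → 2 ^ ⌊log₂ n ⌋ ≤ n) step
  where
  step : ∀ n → (∀ {h} → h < n → 1 ≤ h → 2 ^ ⌊log₂ h ⌋ ≤ h) → 1 ≤ n → 2 ^ ⌊log₂ n ⌋ ≤ n
  step 1 _ _ = ≤-reflexive (cong (2 ^_) (⌊log₂[2^n]⌋≡n 0))
  step n@(suc (suc n')) ih _ = subst (λ t → 2 ^ t ≤ n) (sym log-n) bound
    where
    L = ⌊log₂ ⌊ n /2⌋ ⌋
    log-n : ⌊log₂ n ⌋ ≡ suc L
    log-n = trans (sym (m+[n∸m]≡n (1≤⌊log₂⌋ {n} (s≤s (s≤s z≤n))))) (cong suc (sym (⌊log₂⌊n/2⌋⌋≡⌊log₂n⌋∸1 n)))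
    half : 2 ^ L ≤ ⌊ n /2⌋
    half = ih (⌊n/2⌋<n (suc n')) (s≤s z≤n)
    bound : 2 ^ suc L ≤ n
    bound = begin
      2 ^ L + (2 ^ L + 0) ≡⟨ cong (2 ^ L +_) (+-identityʳ _) ⟩
      2 ^ L + 2 ^ L       ≤⟨ +-mono-≤ half (≤-trans half (⌊n/2⌋≤⌈n/2⌉ n)) ⟩
      ⌊ n /2⌋ + ⌈ n /2⌉   ≡⟨ ⌊n/2⌋+⌈n/2⌉≡n n ⟩
      n                   ∎
      where open ≤-Reasoning

OntoDominationMapping : ℕ → ℕ → Set
OntoDominationMapping m k =
  Σ (Vec Bool m → Vec Bool k) λ ψ →
    IsDominationMapping m k 1 ψ × ((y : Vec Bool k) → InBall 1 y → ∃ λ x → ψ x ≡ y)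

φ-onto-domination-mapping : ∀ m → OntoDominationMapping m (2 ^ m ∸ 1)
φ-onto-domination-mapping m =
  subst (OntoDominationMapping m) (N≡2^m∸1 m) (φ m , φ-domination-mapping m , φ-onto-ball m)

has-mapping : ∀ m → HasDominationMapping m (2 ^ m ∸ 1) 1
has-mapping m = let (ψ , mapping , _) = φ-onto-domination-mapping m in ψ , mapping

μ-upper : ∀ m n → HasDominationMapping m n 1 → m ≤ ⌊log₂ (n + 1) ⌋
μ-upper m n hm = subst (_≤ ⌊log₂ (n + 1) ⌋) (⌊log₂[2^n]⌋≡n m)
  (⌊log₂⌋-mono-≤ (subst (2 ^ m ≤_) (+-comm 1 n) (mapping-counting m n hm)))

mapping-if-2^m≤n+1 : ∀ m n → 1 ≤ m → 2 ^ m ≤ suc n → HasDominationMapping m n 1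
mapping-if-2^m≤n+1 (suc m) n _ 2^m≤1+n =
  subst (λ t → HasDominationMapping (suc m) t 1) (m+[n∸m]≡n (∸-monoˡ-≤ 1 2^m≤1+n))
        (pad (n ∸ (2 ^ suc m ∸ 1)) (has-mapping (suc m)))

μ-attained : ∀ n → 1 ≤ n → HasDominationMapping ⌊log₂ (n + 1) ⌋ n 1
μ-attained n 1≤n = mapping-if-2^m≤n+1 ⌊log₂ (n + 1) ⌋ n
  (1≤⌊log₂⌋ {n + 1} (subst (2 ≤_) 1+n≡n+1 (s≤s 1≤n)))
  (subst (2 ^ ⌊log₂ (n + 1) ⌋ ≤_) (sym 1+n≡n+1) (2^⌊log₂n⌋≤n (n + 1) (subst (1 ≤_) 1+n≡n+1 (s≤s z≤n))))
  where
  1+n≡n+1 : suc n ≡ n + 1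
  1+n≡n+1 = +-comm 1 n

theorem13 :
    ((m : ℕ) → 1 ≤ m →
      Σ (Vec Bool m → Vec Bool (2 ^ m ∸ 1)) λ φ →
        IsDominationMapping m (2 ^ m ∸ 1) 1 φ ×
        ((y : Vec Bool (2 ^ m ∸ 1)) → InBall 1 y → ∃ λ x → φ x ≡ y)) ×
    ((m : ℕ) → 1 ≤ m → IsNu m 1 (2 ^ m ∸ 1)) ×
    ((n : ℕ) → 1 ≤ n → IsMu n 1 ⌊log₂ (n + 1) ⌋)
theorem13 = onto , ν-exact , μ-exact
  where
  onto : (m : ℕ) → 1 ≤ m → OntoDominationMapping m (2 ^ m ∸ 1)
  onto m _ = φ-onto-domination-mapping m

  ν-exact : (m : ℕ) → 1 ≤ m → IsNu m 1 (2 ^ m ∸ 1)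
  ν-exact m _ = has-mapping m , λ n hm → ∸-monoˡ-≤ 1 (mapping-counting m n hm)

  μ-exact : (n : ℕ) → 1 ≤ n → IsMu n 1 ⌊log₂ (n + 1) ⌋
  μ-exact n 1≤n = μ-attained n 1≤n , λ m → μ-upper m n
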